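{- (Rogers formula.) Let $0<|q|<1$ and $x,y,u,v,w\in\mathbb{C}$. Then $$\sum_{n=0}^{\infty}\sum_{m=0}^{\infty}\mathrm{R}_{n+m}(x,y;u|q)\frac{v^{\binom{n}{2}}w^{\binom{m}{2}}t^{n}s^{m}}{(q;q)_{n}(q;q)_{m}}=\sum_{k=0}^{\infty}\sum_{n=0}^{\infty}(uv)^{\binom{k}{2}}(uw)^{\binom{n}{2}}\frac{(ty)^{k}}{(q;q)_{k}}\frac{(u^{k}sy)^{n}}{(q;q)_{n}}\,\mathrm{e}_{q}(tv^{k}x,v)\,\mathrm{e}_{q}(sq^{k}w^{n}x,w).$$
   Context: $(a;q)_n=\prod_{k=0}^{n-1}(1-aq^k)$, $\genfrac{[}{]}{0pt}{}{n}{k}_{q}=\frac{(q;q)_n}{(q;q)_k(q;q)_{n-k}}$, $\mathrm{R}_{n}(x,y;u|q)=\sum_{k=0}^{n}\genfrac{[}{]}{0pt}{}{n}{k}_{q}u^{\binom{k}{2}}x^{n-k}y^{k}$, and $\mathrm{e}_{q}(z,u)=\sum_{n=0}^{\infty}u^{\binom{n}{2}}\frac{z^{n}}{(q;q)_{n}}$ (with $0^0=1$). The identity is understood as an identity of formal power series in $t$ and $s$. -}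

module Defs where

open import Level using (Level)
open import Data.Nat as ℕ using (ℕ; zero; suc; _∸_)
open import Data.Nat.Combinatorics using (_C_)
open import Algebra.Bundles using (CommutativeRing)
open import Relation.Nullary using (yes; no)

-- Everything is stated over an arbitrary commutative ring R (ℂ being the
-- intended instance).
module _ {c ℓ : Level} (R : CommutativeRing c ℓ) where
  open CommutativeRing R

  pow : Carrier → ℕ → Carrier
  pow x zero    = 1#
  pow x (suc n) = x * pow x n

  sumTo : ℕ → (ℕ → Carrier) → Carrier
  sumTo zero    f = f 0
  sumTo (suc n) f = sumTo n f + f (suc n)

  poch : Carrier → Carrier → ℕ → Carrier
  poch a q zero    = 1#
  poch a q (suc n) = poch a q n * (1# - a * pow q n)

  -- "division by (q;q)_n": multiplication by a given inverse inv n of (q;q)_n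
  -- q-binomial [n k]_q = (q;q)_n / ((q;q)_k (q;q)_{n-k})
  qbinom : (inv : ℕ → Carrier) (q : Carrier) → ℕ → ℕ → Carrier
  qbinom inv q n k = poch q q n * inv k * inv (n ∸ k)

  Rpoly : (inv : ℕ → Carrier) (q x y u : Carrier) → ℕ → Carrier
  Rpoly inv q x y u n =
    sumTo n (λ k → qbinom inv q n k * pow u (k C 2) * pow x (n ∸ k) * pow y k)

  -- Formal power series in two variables t, s: coefficient of t^N s^M.
  PS2 : Set c
  PS2 = ℕ → ℕ → Carrier

  _⊗_ : PS2 → PS2 → PS2
  (f ⊗ g) N M = sumTo N (λ i → sumTo M (λ j → f i j * g (N ∸ i) (M ∸ j)))

  mono : Carrier → ℕ → ℕ → PS2
  mono a k n N M with N ℕ.≟ k | M ℕ.≟ n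
  ... | yes _ | yes _ = a
  ... | _       | _       = 0#

  eqT : (inv : ℕ → Carrier) → Carrier → Carrier → PS2
  eqT inv a v N zero    = pow v (N C 2) * pow a N * inv N
  eqT inv a v N (suc M) = 0#

  eqS : (inv : ℕ → Carrier) → Carrier → Carrier → PS2
  eqS inv a w zero    M = pow w (M C 2) * pow a M * inv M
  eqS inv a w (suc N) M = 0#

  -- Σ_{k,n ≥ 0} F k n for a family with F k n = O(t^k s^n) (i.e. F k n N M = 0
  -- unless k ≤ N and n ≤ M): the sum is then coefficientwise finite.
  dsum : (ℕ → ℕ → PS2) → PS2
  dsum F N M = sumTo N (λ k → sumTo M (λ n → F k n N M))

  rogersLHS : (inv : ℕ → Carrier) (q x y u v w : Carrier) → PS2
  rogersLHS inv q x y u v w =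
    dsum (λ n m → mono (Rpoly inv q x y u (n ℕ.+ m) * pow v (n C 2) * pow w (m C 2)
                        * inv n * inv m) n m)

  rogersRHS : (inv : ℕ → Carrier) (q x y u v w : Carrier) → PS2
  rogersRHS inv q x y u v w =
    dsum (λ k n →
      (mono (pow (u * v) (k C 2) * pow (u * w) (n C 2)
             * pow y k * inv k * pow (pow u k * y) n * inv n) k n
        ⊗ eqT inv (pow v k * x) v)
        ⊗ eqS inv (pow q k * pow w n * x) w)

{-# OPTIONS --safe #-}
module Submission where

-- Let T act on functions by (T f)(z) = x f(qz) + z f(uz). The q-Pascal rule shows
-- (Tᵐ f)(z) = Σᵢ [m i]_q u^C(i,2) zⁱ x^(m-i) f(q^(m-i) uⁱ z); in particular R_n(x,z;u|q) = (Tⁿ 1)(z),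
-- and T^(N+M) = T^M ∘ T^N yields the addition formula
--   R_(N+M)(x,y) = Σₙ [M n]_q u^C(n,2) yⁿ x^(M-n) R_N(x, q^(M-n) uⁿ y).
-- The coefficient of t^N s^M on the right-hand side is this double sum term by term, once
-- v^C(N,2) = v^C(k,2) v^C(N-k,2) v^(k(N-k)) (likewise for w) and 1/((q;q)_k (q;q)_(N-k)) = [N k]_q/(q;q)_N.

open import Defs
open import Level using (Level)
open import Data.Nat using (ℕ)
open import Algebra.Bundles using (CommutativeRing)

open import Data.Nat.Base as Nat using (zero; suc; _∸_; _≤_; _<_; z≤n; s≤s)
import Data.Nat.Properties as NatP
open NatP
  using (≤-refl; m≤n⇒m≤1+n; ≤∧≢⇒<; m≤n⇒m<n∨m≡n; m>n⇒m∸n≢0; +-∸-assoc; m+[n∸m]≡n; n∸n≡0; _≟_; ≟-diag)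
open import Data.Nat.Combinatorics using (_C_; nC1≡n; nCk+nC[k+1]≡[n+1]C[k+1])
open import Data.Nat.Tactic.RingSolver using (solve-∀)
open import Data.Sum.Base using (inj₁; inj₂)
open import Relation.Binary.PropositionalEquality as ≡ using (_≡_; _≢_; ≢-sym)
open import Relation.Nullary.Decidable using (yes; no; dec-no)
open import Relation.Nullary.Negation using (contradiction)
import Algebra.Definitions
import Algebra.Properties.CommutativeSemiring.Exp as Exp
import Algebra.Properties.Ring as RingProperties
import Algebra.Solver.Ring.NaturalCoefficients.Default as SemiringSolver
import Relation.Binary.Reasoning.Setoid as SetoidReasoning

module _ where
  open Nat using (_+_; _*_)

  C2-suc : ∀ n → suc n C 2 ≡ n C 2 + n
  C2-suc n = ≡.trans (≡.sym (nCk+nC[k+1]≡[n+1]C[k+1] n 1))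
                     (≡.trans (≡.cong (_+ n C 2) (nC1≡n n)) (NatP.+-comm n (n C 2)))

  C2-+ : ∀ m n → (m + n) C 2 ≡ m C 2 + n C 2 + m * n
  C2-+ zero    n = ≡.sym (NatP.+-identityʳ (n C 2))
  C2-+ (suc m) n = begin
      suc (m + n) C 2                       ≡⟨ C2-suc (m + n) ⟩
      (m + n) C 2 + (m + n)                 ≡⟨ ≡.cong (_+ (m + n)) (C2-+ m n) ⟩
      m C 2 + n C 2 + m * n + (m + n)       ≡⟨ regroup (m C 2) (n C 2) m n ⟩
      m C 2 + m + n C 2 + (n + m * n)       ≡⟨ ≡.cong (λ e → e + n C 2 + (n + m * n)) (≡.sym (C2-suc m)) ⟩
      suc m C 2 + n C 2 + suc m * n         ∎
    where
    open ≡.≡-Reasoning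
    regroup : ∀ a b m n → a + b + m * n + (m + n) ≡ a + m + b + (n + m * n)
    regroup = solve-∀

module Rogers {c ℓ : Level} (R : CommutativeRing c ℓ) where
  open CommutativeRing R hiding (zero)
  open Algebra.Definitions _≈_ using (Congruent₁)
  open RingProperties ring using (x[y-z]≈xy-xz)
  open SemiringSolver commutativeSemiring using (solve; _:=_; _:+_; _:*_)
  open SetoidReasoning setoid
  private module E = Exp commutativeSemiring

  infixr 8 _^_
  _^_ : Carrier → ℕ → Carrier
  _^_ = pow R

  ^≡E^ : ∀ a n → a ^ n ≡ a E.^ n
  ^≡E^ a zero    = ≡.refl
  ^≡E^ a (suc n) = ≡.cong (a *_) (^≡E^ a n)

  ^-congˡ : ∀ n {a b} → a ≈ b → a ^ n ≈ b ^ n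
  ^-congˡ n {a} {b} a≈b rewrite ^≡E^ a n | ^≡E^ b n = E.^-congˡ n a≈b

  ^-homo-* : ∀ a m n → a ^ (m Nat.+ n) ≈ a ^ m * a ^ n
  ^-homo-* a m n rewrite ^≡E^ a (m Nat.+ n) | ^≡E^ a m | ^≡E^ a n = E.^-homo-* a m n

  ^-distrib-* : ∀ a b n → (a * b) ^ n ≈ a ^ n * b ^ n
  ^-distrib-* a b n rewrite ^≡E^ (a * b) n | ^≡E^ a n | ^≡E^ b n = E.^-distrib-* a b n

  ^-distrib-*₃ : ∀ a b d n → (a * b * d) ^ n ≈ a ^ n * b ^ n * d ^ n
  ^-distrib-*₃ a b d n = trans (^-distrib-* (a * b) d n) (*-congʳ (^-distrib-* a b n))

  ^-assocʳ : ∀ a m n → (a ^ m) ^ n ≈ a ^ (m Nat.* n)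
  ^-assocʳ a m n rewrite ^≡E^ (a ^ m) n | ^≡E^ a m | ^≡E^ a (m Nat.* n) = E.^-assocʳ a m n

  ^-comm : ∀ a m n → (a ^ m) ^ n ≈ (a ^ n) ^ m
  ^-comm a m n = trans (^-assocʳ a m n) (trans (reflexive (≡.cong (a ^_) (NatP.*-comm m n))) (sym (^-assocʳ a n m)))

  ^-C2-suc : ∀ a n → a ^ (suc n C 2) ≈ a ^ (n C 2) * a ^ n
  ^-C2-suc a n = trans (reflexive (≡.cong (a ^_) (C2-suc n))) (^-homo-* a (n C 2) n)

  ^-C2-split : ∀ a {k n} → k ≤ n → a ^ (k C 2) * a ^ ((n ∸ k) C 2) * (a ^ k) ^ (n ∸ k) ≈ a ^ (n C 2)
  ^-C2-split a {k} {n} k≤n = begin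
      a ^ (k C 2) * a ^ ((n ∸ k) C 2) * (a ^ k) ^ (n ∸ k)
    ≈⟨ *-cong (sym (^-homo-* a (k C 2) ((n ∸ k) C 2))) (^-assocʳ a k (n ∸ k)) ⟩
      a ^ (k C 2 Nat.+ (n ∸ k) C 2) * a ^ (k Nat.* (n ∸ k))
    ≈⟨ sym (^-homo-* a (k C 2 Nat.+ (n ∸ k) C 2) (k Nat.* (n ∸ k))) ⟩
      a ^ (k C 2 Nat.+ (n ∸ k) C 2 Nat.+ k Nat.* (n ∸ k))
    ≈⟨ reflexive (≡.cong (a ^_) (≡.trans (≡.sym (C2-+ k (n ∸ k))) (≡.cong (_C 2) (m+[n∸m]≡n k≤n)))) ⟩
      a ^ (n C 2)
    ∎

  ∑ : ℕ → (ℕ → Carrier) → Carrier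
  ∑ = sumTo R

  syntax ∑ n (λ i → e) = ∑[ i ≤ n ] e

  ∑-cong : ∀ n {f g : ℕ → Carrier} → (∀ i → i ≤ n → f i ≈ g i) → ∑ n f ≈ ∑ n g
  ∑-cong zero    f≈g = f≈g 0 z≤n
  ∑-cong (suc n) f≈g = +-cong (∑-cong n (λ i i≤n → f≈g i (m≤n⇒m≤1+n i≤n))) (f≈g (suc n) ≤-refl)

  ∑-zero : ∀ n {f : ℕ → Carrier} → (∀ i → i ≤ n → f i ≈ 0#) → ∑ n f ≈ 0#
  ∑-zero n f≈0 = trans (∑-cong n f≈0) (∑-0 n)
    where
    ∑-0 : ∀ n → ∑[ i ≤ n ] 0# ≈ 0#
    ∑-0 zero    = refl
    ∑-0 (suc n) = trans (+-identityʳ _) (∑-0 n)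

  ∑-distrib-+ : ∀ n (f g : ℕ → Carrier) → ∑[ i ≤ n ] (f i + g i) ≈ ∑ n f + ∑ n g
  ∑-distrib-+ zero    f g = refl
  ∑-distrib-+ (suc n) f g = trans (+-congʳ (∑-distrib-+ n f g))
    (solve 4 (λ a b d e → (a :+ b) :+ (d :+ e) := (a :+ d) :+ (b :+ e)) refl _ _ _ _)

  *-distribˡ-∑ : ∀ n a (f : ℕ → Carrier) → a * ∑ n f ≈ ∑[ i ≤ n ] (a * f i)
  *-distribˡ-∑ zero    a f = refl
  *-distribˡ-∑ (suc n) a f = trans (distribˡ _ _ _) (+-congʳ (*-distribˡ-∑ n a f))

  ∑-suc : ∀ n (f : ℕ → Carrier) → ∑ (suc n) f ≈ f 0 + ∑[ i ≤ n ] f (suc i)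
  ∑-suc zero    f = refl
  ∑-suc (suc n) f = trans (+-congʳ (∑-suc n f)) (+-assoc _ _ _)

  ∑-comm : ∀ m n (f : ℕ → ℕ → Carrier) → ∑[ i ≤ m ] ∑[ j ≤ n ] f i j ≈ ∑[ j ≤ n ] ∑[ i ≤ m ] f i j
  ∑-comm zero    n f = refl
  ∑-comm (suc m) n f = trans (+-congʳ (∑-comm m n f)) (sym (∑-distrib-+ n _ (f (suc m))))

  ∑-select : ∀ n {f : ℕ → Carrier} {k} → k ≤ n → (∀ i → i ≤ n → i ≢ k → f i ≈ 0#) → ∑ n f ≈ f k
  ∑-select zero    z≤n _ = refl
  ∑-select (suc n) {f} {k} k≤1+n f≈0 with k ≟ suc n
  ... | yes ≡.refl =
    trans (+-congʳ (∑-zero n (λ i i≤n → f≈0 i (m≤n⇒m≤1+n i≤n) (NatP.<⇒≢ (s≤s i≤n)))))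
                           (+-identityˡ _)
  ... | no k≢1+n   =
    trans (+-cong (∑-select n (NatP.≤-pred (≤∧≢⇒< k≤1+n k≢1+n)) (λ i i≤n → f≈0 i (m≤n⇒m≤1+n i≤n)))
                                   (f≈0 (suc n) ≤-refl (≢-sym k≢1+n)))
                           (+-identityʳ _)

  SeriesInT : PS2 R → Set ℓ
  SeriesInT g = ∀ i j → j ≢ 0 → g i j ≈ 0#

  SeriesInS : PS2 R → Set ℓ
  SeriesInS g = ∀ i j → i ≢ 0 → g i j ≈ 0#

  eqT-SeriesInT : ∀ inv a v → SeriesInT (eqT R inv a v)
  eqT-SeriesInT inv a v i zero    j≢0 = contradiction ≡.refl j≢0
  eqT-SeriesInT inv a v i (suc j) _   = refl

  eqS-SeriesInS : ∀ inv a w → SeriesInS (eqS R inv a w)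
  eqS-SeriesInS inv a w zero    j i≢0 = contradiction ≡.refl i≢0
  eqS-SeriesInS inv a w (suc i) j _   = refl

  mono-diag : ∀ a k n → mono R a k n k n ≈ a
  mono-diag a k n rewrite ≟-diag (≡.refl {x = k}) | ≟-diag (≡.refl {x = n}) = refl

  mono-offˡ : ∀ a {k n i} j → i ≢ k → mono R a k n i j ≈ 0#
  mono-offˡ a {k} {i = i} j i≢k rewrite dec-no (i ≟ k) i≢k = refl

  mono-offʳ : ∀ a {k n} i {j} → j ≢ n → mono R a k n i j ≈ 0#
  mono-offʳ a {k} {n} i {j} j≢n with i ≟ k
  ... | yes _ rewrite dec-no (j ≟ n) j≢n = refl
  ... | no _  = refl

  dsum-mono : ∀ (a : ℕ → ℕ → Carrier) N M → dsum R (λ n m → mono R (a n m) n m) N M ≈ a N M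
  dsum-mono a N M = begin
      ∑[ n ≤ N ] ∑[ m ≤ M ] mono R (a n m) n m N M
    ≈⟨ ∑-select N ≤-refl (λ n _ n≢N → ∑-zero M (λ m _ → mono-offˡ _ M (≢-sym n≢N))) ⟩
      ∑[ m ≤ M ] mono R (a N m) N m N M
    ≈⟨ ∑-select M ≤-refl (λ m _ m≢M → mono-offʳ _ N (≢-sym m≢M)) ⟩
      mono R (a N M) N M N M
    ≈⟨ mono-diag _ N M ⟩
      a N M
    ∎

  mono-⊗ : ∀ a {k n N M} g → k ≤ N → n ≤ M → (_⊗_ R (mono R a k n) g) N M ≈ a * g (N ∸ k) (M ∸ n)
  mono-⊗ a {k} {n} {N} {M} g k≤N n≤M = begin
      ∑[ i ≤ N ] ∑[ j ≤ M ] (mono R a k n i j * g (N ∸ i) (M ∸ j))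
    ≈⟨ ∑-select N k≤N (λ i _ i≢k → ∑-zero M (λ j _ → trans (*-congʳ (mono-offˡ a j i≢k)) (zeroˡ _))) ⟩
      ∑[ j ≤ M ] (mono R a k n k j * g (N ∸ k) (M ∸ j))
    ≈⟨ ∑-select M n≤M (λ j _ j≢n → trans (*-congʳ (mono-offʳ a k j≢n)) (zeroˡ _)) ⟩
      mono R a k n k n * g (N ∸ k) (M ∸ n)
    ≈⟨ *-congʳ (mono-diag a k n) ⟩
      a * g (N ∸ k) (M ∸ n)
    ∎

  mono-⊗-off : ∀ a {k n} N {j} {g} → SeriesInT g → j ≢ n → (_⊗_ R (mono R a k n) g) N j ≈ 0#
  mono-⊗-off a {k} {n} N {j} {g} g∈T j≢n = ∑-zero N (λ i _ → ∑-zero j (term i))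
    where
    term : ∀ i j′ → j′ ≤ j → mono R a k n i j′ * g (N ∸ i) (j ∸ j′) ≈ 0#
    -- deciding n ≟ j′ rather than j′ ≟ n keeps the test inside mono from being abstracted
    term i j′ j′≤j with n ≟ j′
    ... | yes ≡.refl = trans (*-congˡ (g∈T _ _ (m>n⇒m∸n≢0 (≤∧≢⇒< j′≤j (≢-sym j≢n))))) (zeroʳ _)
    ... | no n≢j′    = trans (*-congʳ (mono-offʳ a i (≢-sym n≢j′))) (zeroˡ _)

  ⊗-SeriesInS : ∀ f {h} → SeriesInS h → ∀ N M → (_⊗_ R f h) N M ≈ ∑[ j ≤ M ] (f N j * h 0 (M ∸ j))
  ⊗-SeriesInS f {h} h∈S N M = begin
      ∑[ i ≤ N ] ∑[ j ≤ M ] (f i j * h (N ∸ i) (M ∸ j))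
    ≈⟨ ∑-select N ≤-refl (λ i i≤N i≢N → ∑-zero M (λ j _ →
         trans (*-congˡ (h∈S _ _ (m>n⇒m∸n≢0 (≤∧≢⇒< i≤N i≢N)))) (zeroʳ _))) ⟩
      ∑[ j ≤ M ] (f N j * h (N ∸ N) (M ∸ j))
    ≈⟨ ∑-cong M (λ j _ → *-congˡ (reflexive (≡.cong (λ i → h i (M ∸ j)) (n∸n≡0 N)))) ⟩
      ∑[ j ≤ M ] (f N j * h 0 (M ∸ j))
    ∎

  mono-⊗-⊗ : ∀ a {k n N M g h} → SeriesInT g → SeriesInS h → k ≤ N → n ≤ M →
             (_⊗_ R (_⊗_ R (mono R a k n) g) h) N M ≈ a * g (N ∸ k) 0 * h 0 (M ∸ n)
  mono-⊗-⊗ a {k} {n} {N} {M} {g} {h} g∈T h∈S k≤N n≤M = begin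
      (_⊗_ R (_⊗_ R (mono R a k n) g) h) N M
    ≈⟨ ⊗-SeriesInS _ h∈S N M ⟩
      ∑[ j ≤ M ] ((_⊗_ R (mono R a k n) g) N j * h 0 (M ∸ j))
    ≈⟨ ∑-select M n≤M (λ j _ j≢n → trans (*-congʳ (mono-⊗-off a N g∈T j≢n)) (zeroˡ _)) ⟩
      (_⊗_ R (mono R a k n) g) N n * h 0 (M ∸ n)
    ≈⟨ *-congʳ (mono-⊗ a {M = n} g k≤N ≤-refl) ⟩
      a * g (N ∸ k) (n ∸ n) * h 0 (M ∸ n)
    ≈⟨ *-congʳ (*-congˡ (reflexive (≡.cong (g (N ∸ k)) (n∸n≡0 n)))) ⟩
      a * g (N ∸ k) 0 * h 0 (M ∸ n)
    ∎

  [1-a]+a[1-b]≈1-ab : ∀ a b → (1# - a) + a * (1# - b) ≈ 1# - a * b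
  [1-a]+a[1-b]≈1-ab a b = begin
      (1# - a) + a * (1# - b)
    ≈⟨ +-congˡ (trans (x[y-z]≈xy-xz a 1# b) (+-congʳ (*-identityʳ a))) ⟩
      (1# - a) + (a - a * b)
    ≈⟨ solve 4 (λ o a′ a ab′ → (o :+ a′) :+ (a :+ ab′) := (o :+ ab′) :+ (a :+ a′)) refl 1# (- a) a (- (a * b)) ⟩
      (1# - a * b) + (a - a)
    ≈⟨ trans (+-congˡ (-‿inverseʳ a)) (+-identityʳ _) ⟩
      1# - a * b
    ∎

  module _ (q : Carrier) where

    -- [n k]_q by the q-Pascal rule, so that no inverses are needed; qbinom≈gaussian recovers the quotient.
    gaussian : ℕ → ℕ → Carrier
    gaussian zero    zero    = 1#
    gaussian zero    (suc k) = 0#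
    gaussian (suc n) zero    = 1#
    gaussian (suc n) (suc k) = q ^ suc k * gaussian n (suc k) + gaussian n k

    gaussian-0 : ∀ n → gaussian n 0 ≈ 1#
    gaussian-0 zero    = refl
    gaussian-0 (suc n) = refl

    gaussian-> : ∀ {n k} → n < k → gaussian n k ≈ 0#
    gaussian-> {zero}  {suc k} _         = refl
    gaussian-> {suc n} {suc k} (s≤s n<k) = begin
        q ^ suc k * gaussian n (suc k) + gaussian n k
      ≈⟨ +-cong (*-congˡ (gaussian-> (m≤n⇒m≤1+n n<k))) (gaussian-> n<k) ⟩
        q ^ suc k * 0# + 0#
      ≈⟨ trans (+-identityʳ _) (zeroʳ _) ⟩
        0#
      ∎

    ∑-qPascal : ∀ m (h : ℕ → Carrier) →
      ∑[ i ≤ suc m ] (gaussian (suc m) i * h i)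
        ≈ ∑[ i ≤ m ] (q ^ i * gaussian m i * h i) + ∑[ i ≤ m ] (gaussian m i * h (suc i))
    ∑-qPascal m h = begin
        ∑[ i ≤ suc m ] (gaussian (suc m) i * h i)
      ≈⟨ ∑-suc m _ ⟩
        1# * h 0 + ∑[ i ≤ m ] ((q ^ suc i * gaussian m (suc i) + gaussian m i) * h (suc i))
      ≈⟨ +-congˡ (trans (∑-cong m (λ i _ → distribʳ _ _ _)) (∑-distrib-+ m _ _)) ⟩
        1# * h 0 + (∑[ i ≤ m ] (q ^ suc i * gaussian m (suc i) * h (suc i)) + ∑[ i ≤ m ] (gaussian m i * h (suc i)))
      ≈⟨ sym (+-assoc _ _ _) ⟩
        (1# * h 0 + ∑[ i ≤ m ] (q ^ suc i * gaussian m (suc i) * h (suc i))) + ∑[ i ≤ m ] (gaussian m i * h (suc i))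
      ≈⟨ +-congʳ (sym unshift) ⟩
        ∑[ i ≤ m ] (q ^ i * gaussian m i * h i) + ∑[ i ≤ m ] (gaussian m i * h (suc i))
      ∎
      where
      unshift : ∑[ i ≤ m ] (q ^ i * gaussian m i * h i)
                  ≈ 1# * h 0 + ∑[ i ≤ m ] (q ^ suc i * gaussian m (suc i) * h (suc i))
      unshift = begin
          ∑[ i ≤ m ] (q ^ i * gaussian m i * h i)
        ≈⟨ sym (trans (+-congˡ (trans (*-congʳ (trans (*-congˡ (gaussian-> {m} ≤-refl)) (zeroʳ _))) (zeroˡ _)))
                      (+-identityʳ _)) ⟩
          ∑[ i ≤ suc m ] (q ^ i * gaussian m i * h i)
        ≈⟨ ∑-suc m _ ⟩
          1# * gaussian m 0 * h 0 + ∑[ i ≤ m ] (q ^ suc i * gaussian m (suc i) * h (suc i))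
        ≈⟨ +-congʳ (*-congʳ (trans (*-identityˡ _) (gaussian-0 m))) ⟩
          1# * h 0 + ∑[ i ≤ m ] (q ^ suc i * gaussian m (suc i) * h (suc i))
        ∎

    qPoch : ℕ → Carrier
    qPoch = poch R q q

    qPoch-split : ∀ {n k} → k ≤ n → qPoch n ≈ gaussian n k * qPoch k * qPoch (n ∸ k)
    qPoch-split {n} {zero} _ = sym (begin
        gaussian n 0 * 1# * qPoch n  ≈⟨ *-congʳ (trans (*-identityʳ _) (gaussian-0 n)) ⟩
        1# * qPoch n                 ≈⟨ *-identityˡ _ ⟩
        qPoch n                      ∎)
    qPoch-split {suc n} {suc k} (s≤s k≤n) = sym (begin
        (a * gaussian n (suc k) + gaussian n k) * (qPoch k * (1# - a)) * qPoch (n ∸ k)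
      ≈⟨ solve 6 (λ a G₁ G₀ P o P′ → (a :* G₁ :+ G₀) :* (P :* o) :* P′
                                  := a :* (G₁ :* (P :* o) :* P′) :+ G₀ :* P :* P′ :* o)
               refl a (gaussian n (suc k)) (gaussian n k) (qPoch k) (1# - a) (qPoch (n ∸ k)) ⟩
        a * (gaussian n (suc k) * qPoch (suc k) * qPoch (n ∸ k)) + gaussian n k * qPoch k * qPoch (n ∸ k) * (1# - a)
      ≈⟨ +-cong (*-congˡ upper) (*-congʳ (sym (qPoch-split k≤n))) ⟩
        a * (qPoch n * (1# - q ^ (n ∸ k))) + qPoch n * (1# - a)
      ≈⟨ solve 4 (λ a P B A → a :* (P :* B) :+ P :* A := P :* (A :+ a :* B))
               refl a (qPoch n) (1# - q ^ (n ∸ k)) (1# - a) ⟩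
        qPoch n * ((1# - a) + a * (1# - q ^ (n ∸ k)))
      ≈⟨ *-congˡ ([1-a]+a[1-b]≈1-ab a (q ^ (n ∸ k))) ⟩
        qPoch n * (1# - a * q ^ (n ∸ k))
      ≈⟨ *-congˡ (+-congˡ (-‿cong exponent)) ⟩
        qPoch n * (1# - q ^ suc n)
      ∎)
      where
      a = q ^ suc k
      exponent : a * q ^ (n ∸ k) ≈ q ^ suc n
      exponent = trans (sym (^-homo-* q (suc k) (n ∸ k))) (reflexive (≡.cong (λ e → q ^ suc e) (m+[n∸m]≡n k≤n)))
      upper : gaussian n (suc k) * qPoch (suc k) * qPoch (n ∸ k) ≈ qPoch n * (1# - q ^ (n ∸ k))
      upper with m≤n⇒m<n∨m≡n k≤n
      ... | inj₁ k<n rewrite +-∸-assoc 1 k<n = trans (sym (*-assoc _ _ _)) (*-congʳ (sym (qPoch-split k<n)))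
      ... | inj₂ ≡.refl rewrite n∸n≡0 n = begin
          gaussian n (suc n) * qPoch (suc n) * 1#  ≈⟨ *-congʳ (*-congʳ (gaussian-> {n} ≤-refl)) ⟩
          0# * qPoch (suc n) * 1#                  ≈⟨ trans (*-congʳ (zeroˡ _)) (zeroˡ _) ⟩
          0#                                       ≈⟨ sym (trans (*-congˡ (-‿inverseʳ 1#)) (zeroʳ _)) ⟩
          qPoch n * (1# - 1#)                      ∎

    module _ (x u : Carrier) where

      T : (Carrier → Carrier) → Carrier → Carrier
      T f z = x * f (q * z) + z * f (u * z)

      -- Tᵐ f in closed form
      Tpow : ℕ → (Carrier → Carrier) → Carrier → Carrier
      Tpow m f z = ∑[ i ≤ m ] (gaussian m i * (u ^ (i C 2) * z ^ i * x ^ (m ∸ i) * f (q ^ (m ∸ i) * u ^ i * z)))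

      T-cong : ∀ {f g} → (∀ z → f z ≈ g z) → ∀ z → T f z ≈ T g z
      T-cong f≈g z = +-cong (*-congˡ (f≈g _)) (*-congˡ (f≈g _))

      Tpow-cong : ∀ m {f} → Congruent₁ f → Congruent₁ (Tpow m f)
      Tpow-cong m f-cong z≈z′ =
        ∑-cong m (λ i _ → *-congˡ (*-cong (*-congʳ (*-congˡ (^-congˡ i z≈z′))) (f-cong (*-congˡ z≈z′))))

      Tpow-zero : ∀ {f} → Congruent₁ f → ∀ z → Tpow 0 f z ≈ f z
      Tpow-zero {f} f-cong z = begin
          1# * (1# * 1# * 1# * f (1# * 1# * z))
        ≈⟨ trans (*-identityˡ _) (trans (*-congʳ (trans (*-identityʳ _) (*-identityʳ 1#))) (*-identityˡ _)) ⟩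
          f (1# * 1# * z)
        ≈⟨ f-cong (trans (*-congʳ (*-identityˡ 1#)) (*-identityˡ z)) ⟩
          f z
        ∎

      Tpow-suc : ∀ m {f} → Congruent₁ f → ∀ z → Tpow (suc m) f z ≈ T (Tpow m f) z
      Tpow-suc m {f} f-cong z =
        trans (∑-qPascal m _)
              (+-cong (trans (∑-cong m q-part) (sym (*-distribˡ-∑ m x _)))
                      (trans (∑-cong m u-part) (sym (*-distribˡ-∑ m z _))))
        where
        q-part : ∀ i → i ≤ m →
          q ^ i * gaussian m i * (u ^ (i C 2) * z ^ i * x ^ (suc m ∸ i) * f (q ^ (suc m ∸ i) * u ^ i * z))
            ≈ x * (gaussian m i * (u ^ (i C 2) * (q * z) ^ i * x ^ (m ∸ i) * f (q ^ (m ∸ i) * u ^ i * (q * z))))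
        q-part i i≤m rewrite +-∸-assoc 1 i≤m = sym (begin
            x * (G * (U * (q * z) ^ i * x ^ j * f (q ^ j * u ^ i * (q * z))))
          ≈⟨ *-congˡ (*-congˡ (*-cong (*-congʳ (*-congˡ (^-distrib-* q z i)))
               (f-cong (solve 4 (λ Q U q z → Q :* U :* (q :* z) := q :* Q :* U :* z) refl (q ^ j) (u ^ i) q z)))) ⟩
            x * (G * (U * (q ^ i * z ^ i) * x ^ j * F))
          ≈⟨ solve 7 (λ x G U Q Z X F → x :* (G :* (U :* (Q :* Z) :* X :* F)) := Q :* G :* (U :* Z :* (x :* X) :* F))
               refl x G U (q ^ i) (z ^ i) (x ^ j) F ⟩
            q ^ i * G * (U * z ^ i * (x * x ^ j) * F)
          ∎)
          where
          j = m ∸ i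
          G = gaussian m i
          U = u ^ (i C 2)
          F = f (q * q ^ j * u ^ i * z)
        u-part : ∀ i → i ≤ m →
          gaussian m i * (u ^ (suc i C 2) * z ^ suc i * x ^ (m ∸ i) * f (q ^ (m ∸ i) * u ^ suc i * z))
            ≈ z * (gaussian m i * (u ^ (i C 2) * (u * z) ^ i * x ^ (m ∸ i) * f (q ^ (m ∸ i) * u ^ i * (u * z))))
        u-part i _ = sym (begin
            z * (G * (U * (u * z) ^ i * X * f (q ^ j * u ^ i * (u * z))))
          ≈⟨ *-congˡ (*-congˡ (*-cong (*-congʳ (*-congˡ (^-distrib-* u z i)))
               (f-cong (solve 4 (λ Q U u z → Q :* U :* (u :* z) := Q :* (u :* U) :* z) refl (q ^ j) (u ^ i) u z)))) ⟩
            z * (G * (U * (u ^ i * z ^ i) * X * F))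
          ≈⟨ solve 7 (λ z G U V Z X F → z :* (G :* (U :* (V :* Z) :* X :* F)) := G :* (U :* V :* (z :* Z) :* X :* F))
               refl z G U (u ^ i) (z ^ i) X F ⟩
            G * (U * u ^ i * z ^ suc i * X * F)
          ≈⟨ *-congˡ (*-congʳ (*-congʳ (*-congʳ (sym (^-C2-suc u i))))) ⟩
            G * (u ^ (suc i C 2) * z ^ suc i * X * F)
          ∎)
          where
          j = m ∸ i
          G = gaussian m i
          U = u ^ (i C 2)
          X = x ^ j
          F = f (q ^ j * u ^ suc i * z)

      Tpow-+ : ∀ m n {f} → Congruent₁ f → ∀ z → Tpow m (Tpow n f) z ≈ Tpow (m Nat.+ n) f z
      Tpow-+ zero    n f-cong z = Tpow-zero (Tpow-cong n f-cong) z
      Tpow-+ (suc m) n {f} f-cong z = begin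
          Tpow (suc m) (Tpow n f) z    ≈⟨ Tpow-suc m (Tpow-cong n f-cong) z ⟩
          T (Tpow m (Tpow n f)) z      ≈⟨ T-cong (Tpow-+ m n f-cong) z ⟩
          T (Tpow (m Nat.+ n) f) z     ≈⟨ sym (Tpow-suc (m Nat.+ n) f-cong z) ⟩
          Tpow (suc m Nat.+ n) f z     ∎

  module Coefficients (q : Carrier) (inv : ℕ → Carrier) (inv-qPoch : ∀ n → poch R q q n * inv n ≈ 1#)
                      (x y u v w : Carrier) where

    qbinom≈gaussian : ∀ {n k} → k ≤ n → qbinom R inv q n k ≈ gaussian q n k
    qbinom≈gaussian {n} {k} k≤n = begin
        qPoch q n * inv k * inv (n ∸ k)
      ≈⟨ *-congʳ (*-congʳ (qPoch-split q k≤n)) ⟩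
        G * P * P′ * inv k * inv (n ∸ k)
      ≈⟨ solve 5 (λ G P P′ i i′ → G :* P :* P′ :* i :* i′ := G :* (P :* i) :* (P′ :* i′))
               refl G P P′ (inv k) (inv (n ∸ k)) ⟩
        G * (P * inv k) * (P′ * inv (n ∸ k))
      ≈⟨ *-cong (*-congˡ (inv-qPoch k)) (inv-qPoch (n ∸ k)) ⟩
        G * 1# * 1#
      ≈⟨ trans (*-identityʳ _) (*-identityʳ G) ⟩
        G
      ∎
      where
      G = gaussian q n k
      P = qPoch q k
      P′ = qPoch q (n ∸ k)

    inv-split : ∀ {n k} → k ≤ n → inv k * inv (n ∸ k) ≈ gaussian q n k * inv n
    inv-split {n} {k} k≤n = begin
        inv k * inv (n ∸ k)
      ≈⟨ sym (trans (*-congʳ (inv-qPoch n)) (*-identityˡ _)) ⟩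
        qPoch q n * inv n * (inv k * inv (n ∸ k))
      ≈⟨ solve 4 (λ P i i′ iₙ → P :* iₙ :* (i :* i′) := P :* i :* i′ :* iₙ)
               refl (qPoch q n) (inv k) (inv (n ∸ k)) (inv n) ⟩
        qbinom R inv q n k * inv n
      ≈⟨ *-congʳ (qbinom≈gaussian k≤n) ⟩
        gaussian q n k * inv n
      ∎

    Rpoly≈Tpow : ∀ z n → Rpoly R inv q x z u n ≈ Tpow q x u n (λ _ → 1#) z
    Rpoly≈Tpow z n = ∑-cong n term
      where
      term : ∀ k → k ≤ n → qbinom R inv q n k * u ^ (k C 2) * x ^ (n ∸ k) * z ^ k
                             ≈ gaussian q n k * (u ^ (k C 2) * z ^ k * x ^ (n ∸ k) * 1#)
      term k k≤n = begin
          qbinom R inv q n k * u ^ (k C 2) * x ^ (n ∸ k) * z ^ k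
        ≈⟨ *-congʳ (*-congʳ (*-congʳ (qbinom≈gaussian k≤n))) ⟩
          gaussian q n k * u ^ (k C 2) * x ^ (n ∸ k) * z ^ k
        ≈⟨ solve 4 (λ G U X Z → G :* U :* X :* Z := G :* (U :* Z :* X))
                 refl (gaussian q n k) (u ^ (k C 2)) (x ^ (n ∸ k)) (z ^ k) ⟩
          gaussian q n k * (u ^ (k C 2) * z ^ k * x ^ (n ∸ k))
        ≈⟨ *-congˡ (sym (*-identityʳ _)) ⟩
          gaussian q n k * (u ^ (k C 2) * z ^ k * x ^ (n ∸ k) * 1#)
        ∎

    scale : ℕ → ℕ → Carrier
    scale N M = v ^ (N C 2) * w ^ (M C 2) * inv N * inv M

    rhsTerm : ℕ → ℕ → ℕ → ℕ → Carrier
    rhsTerm N M k n = (u * v) ^ (k C 2) * (u * w) ^ (n C 2) * y ^ k * inv k * (u ^ k * y) ^ n * inv n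
                      * eqT R inv (v ^ k * x) v (N ∸ k) 0 * eqS R inv (q ^ k * w ^ n * x) w 0 (M ∸ n)

    rogersLHS-coeff : ∀ N M → rogersLHS R inv q x y u v w N M ≈ scale N M * Rpoly R inv q x y u (N Nat.+ M)
    rogersLHS-coeff N M = trans (dsum-mono _ N M)
      (solve 5 (λ Rp a b d e → Rp :* a :* b :* d :* e := (a :* b :* d :* e) :* Rp) refl _ _ _ _ _)

    rogersRHS-coeff : ∀ N M → rogersRHS R inv q x y u v w N M ≈ ∑[ k ≤ N ] ∑[ n ≤ M ] rhsTerm N M k n
    rogersRHS-coeff N M = ∑-cong N (λ k k≤N → ∑-cong M (λ n n≤M →
      mono-⊗-⊗ _ (eqT-SeriesInT inv (v ^ k * x) v) (eqS-SeriesInS inv (q ^ k * w ^ n * x) w) k≤N n≤M))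

    Rpoly-+ : ∀ N M → Rpoly R inv q x y u (N Nat.+ M) ≈ Tpow q x u M (Tpow q x u N (λ _ → 1#)) y
    Rpoly-+ N M = begin
        Rpoly R inv q x y u (N Nat.+ M)            ≈⟨ reflexive (≡.cong (Rpoly R inv q x y u) (NatP.+-comm N M)) ⟩
        Rpoly R inv q x y u (M Nat.+ N)            ≈⟨ Rpoly≈Tpow y (M Nat.+ N) ⟩
        Tpow q x u (M Nat.+ N) (λ _ → 1#) y        ≈⟨ sym (Tpow-+ q x u M N {λ _ → 1#} (λ _ → refl) y) ⟩
        Tpow q x u M (Tpow q x u N (λ _ → 1#)) y   ∎

    term-identity : ∀ {N M k n} → k ≤ N → n ≤ M →
      scale N M * gaussian q M n * (u ^ (n C 2) * y ^ n * x ^ (M ∸ n))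
        * (gaussian q N k * (u ^ (k C 2) * (q ^ (M ∸ n) * u ^ n * y) ^ k * x ^ (N ∸ k) * 1#))
        ≈ rhsTerm N M k n
    term-identity {N} {M} {k} {n} k≤N n≤M = begin
        scale N M * Gₘ * (u ^ (n C 2) * y ^ n * x ^ l) * (Gₙ * (u ^ (k C 2) * (q ^ l * u ^ n * y) ^ k * x ^ j * 1#))
      ≈⟨ *-congˡ (*-congˡ (trans (*-identityʳ _) (*-congʳ (*-congˡ shifted-power)))) ⟩
        scale N M * Gₘ * (u ^ (n C 2) * y ^ n * x ^ l) * (Gₙ * (u ^ (k C 2) * (Q * U * y ^ k) * x ^ j))
      ≈⟨ solve 14 (λ a b c d Gₘ uₙ yₙ xₗ Gₙ uₖ Q U yₖ xⱼ →
                     a :* b :* c :* d :* Gₘ :* (uₙ :* yₙ :* xₗ) :* (Gₙ :* (uₖ :* (Q :* U :* yₖ) :* xⱼ))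
                  := a :* b :* (Gₙ :* c) :* (Gₘ :* d) :* (uₖ :* uₙ :* U :* Q :* yₖ :* yₙ :* xⱼ :* xₗ))
           refl (v ^ (N C 2)) (w ^ (M C 2)) (inv N) (inv M) Gₘ (u ^ (n C 2)) (y ^ n) (x ^ l)
                Gₙ (u ^ (k C 2)) Q U (y ^ k) (x ^ j) ⟩
        v ^ (N C 2) * w ^ (M C 2) * (Gₙ * inv N) * (Gₘ * inv M) * Z
      ≈⟨ sym (*-congʳ (*-cong (*-cong (*-cong (^-C2-split v k≤N) (^-C2-split w n≤M)) (inv-split k≤N)) (inv-split n≤M))) ⟩
        v ^ (k C 2) * v ^ (j C 2) * V * (w ^ (n C 2) * w ^ (l C 2) * W) * (inv k * inv j) * (inv n * inv l) * Z
      ≈⟨ solve 18 (λ vₖ vⱼ V wₙ wₗ W iₖ iⱼ iₙ iₗ uₖ uₙ U Q yₖ yₙ xⱼ xₗ →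
                     vₖ :* vⱼ :* V :* (wₙ :* wₗ :* W) :* (iₖ :* iⱼ) :* (iₙ :* iₗ) :* (uₖ :* uₙ :* U :* Q :* yₖ :* yₙ :* xⱼ :* xₗ)
                  := uₖ :* vₖ :* (uₙ :* wₙ) :* yₖ :* iₖ :* (U :* yₙ) :* iₙ :* (vⱼ :* (V :* xⱼ) :* iⱼ) :* (wₗ :* (Q :* W :* xₗ) :* iₗ))
           refl (v ^ (k C 2)) (v ^ (j C 2)) V (w ^ (n C 2)) (w ^ (l C 2)) W (inv k) (inv j) (inv n) (inv l)
                (u ^ (k C 2)) (u ^ (n C 2)) U Q (y ^ k) (y ^ n) (x ^ j) (x ^ l) ⟩
        u ^ (k C 2) * v ^ (k C 2) * (u ^ (n C 2) * w ^ (n C 2)) * y ^ k * inv k * (U * y ^ n) * inv n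
          * (v ^ (j C 2) * (V * x ^ j) * inv j) * (w ^ (l C 2) * (Q * W * x ^ l) * inv l)
      ≈⟨ sym (*-cong (*-cong (*-congʳ (*-cong (*-congʳ (*-congʳ (*-cong (^-distrib-* u v (k C 2)) (^-distrib-* u w (n C 2)))))
                                               (^-distrib-* (u ^ k) y n)))
                             (*-congʳ (*-congˡ (^-distrib-* (v ^ k) x j))))
                     (*-congʳ (*-congˡ (^-distrib-*₃ (q ^ k) (w ^ n) x l)))) ⟩
        rhsTerm N M k n
      ∎
      where
      j = N ∸ k
      l = M ∸ n
      Gₙ = gaussian q N k
      Gₘ = gaussian q M n
      Q = (q ^ k) ^ l
      U = (u ^ k) ^ n
      V = (v ^ k) ^ j
      W = (w ^ n) ^ l
      Z = u ^ (k C 2) * u ^ (n C 2) * U * Q * y ^ k * y ^ n * x ^ j * x ^ l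
      shifted-power : (q ^ l * u ^ n * y) ^ k ≈ Q * U * y ^ k
      shifted-power = trans (^-distrib-*₃ (q ^ l) (u ^ n) y k) (*-congʳ (*-cong (^-comm q l k) (^-comm u n k)))

    scale-Tpow² : ∀ N M → scale N M * Tpow q x u M (Tpow q x u N (λ _ → 1#)) y
                            ≈ ∑[ k ≤ N ] ∑[ n ≤ M ] rhsTerm N M k n
    scale-Tpow² N M = begin
        scale N M * Tpow q x u M (Tpow q x u N (λ _ → 1#)) y
      ≈⟨ *-distribˡ-∑ M _ _ ⟩
        ∑[ n ≤ M ] (scale N M * (gaussian q M n * (A n * ∑[ k ≤ N ] B n k)))
      ≈⟨ ∑-cong M (λ n _ → trans (solve 4 (λ s G a S → s :* (G :* (a :* S)) := s :* G :* a :* S) refl _ _ _ _)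
                                 (*-distribˡ-∑ N _ _)) ⟩
        ∑[ n ≤ M ] ∑[ k ≤ N ] (scale N M * gaussian q M n * A n * B n k)
      ≈⟨ ∑-comm M N _ ⟩
        ∑[ k ≤ N ] ∑[ n ≤ M ] (scale N M * gaussian q M n * A n * B n k)
      ≈⟨ ∑-cong N (λ k k≤N → ∑-cong M (λ n n≤M → term-identity k≤N n≤M)) ⟩
        ∑[ k ≤ N ] ∑[ n ≤ M ] rhsTerm N M k n
      ∎
      where
      A : ℕ → Carrier
      A n = u ^ (n C 2) * y ^ n * x ^ (M ∸ n)
      B : ℕ → ℕ → Carrier
      B n k = gaussian q N k * (u ^ (k C 2) * (q ^ (M ∸ n) * u ^ n * y) ^ k * x ^ (N ∸ k) * 1#)

mainTheorem19 : {c ℓ : Level} (R : CommutativeRing c ℓ) →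
    let open CommutativeRing R in
    (q : Carrier) (inv : ℕ → Carrier) →
    ((n : ℕ) → poch R q q n * inv n ≈ 1#) →
    (x y u v w : Carrier) →
    (N M : ℕ) →
    rogersLHS R inv q x y u v w N M ≈ rogersRHS R inv q x y u v w N M
mainTheorem19 R q inv inv-qPoch x y u v w N M = begin
    rogersLHS R inv q x y u v w N M                              ≈⟨ rogersLHS-coeff N M ⟩
    scale N M * Rpoly R inv q x y u (N Nat.+ M)                  ≈⟨ *-congˡ (Rpoly-+ N M) ⟩
    scale N M * Tpow q x u M (Tpow q x u N (λ _ → 1#)) y         ≈⟨ scale-Tpow² N M ⟩
    ∑[ k ≤ N ] ∑[ n ≤ M ] rhsTerm N M k n                        ≈⟨ sym (rogersRHS-coeff N M) ⟩
    rogersRHS R inv q x y u v w N M                              ∎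
  where
  open CommutativeRing R using (_*_; 1#; sym; *-congˡ; setoid)
  open SetoidReasoning setoid
  open Rogers R using (∑; Tpow)
  open Rogers.Coefficients R q inv inv-qPoch x y u v w
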